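{- Let $\lambda,\mu$ be strict partitions with $\mu\subseteq\lambda$, and let $\mathcal{C},\mathcal{C}'$ be configurations for $\lambda/\mu$ such that $\mathcal{C}'$ is obtained from $\mathcal{C}$ by exchanging the $0$'s of two rows $a$ and $b$, where the pair of types of rows $(a,b)$ in $\mathcal{C}$ and the pair of types in $\mathcal{C}'$ are one of the following: $(e,e),(e,e)\to(e,e),(e,\emptyset)$; $(e,e),(o,o)\to(o,o),(e,\emptyset)$; $(e,o),(e,e)\to(e,o),(e,\emptyset)$; $(e,e),(\emptyset,e)\to(\emptyset,e),(e,\emptyset)$; $(o,o),(o,e)\to(o,o),(o,\emptyset)$; $(o,e),(e,o)\to(e,o),(o,\emptyset)$; $(o,e),(o,e)\to(o,e),(o,\emptyset)$; $(o,e),(\emptyset,o)\to(\emptyset,o),(o,\emptyset)$. Then $\kappa(\mathcal{C}')<\kappa(\mathcal{C})$.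
   Context: Let $S(\lambda)$ be the shifted diagram of $\lambda$ (row $i$ of the Young diagram shifted $i-1$ squares right). A configuration $\mathcal{C}$ of $0$'s for $\lambda/\mu$ assigns to each row $i$ an integer $z_i$ with $0\le z_i\le\lambda_i$ (the leftmost $z_i$ squares of row $i$ are filled with $0$, the other $\lambda_i-z_i$ squares are blank), such that the nonzero $z_i$'s, arranged in decreasing order, are exactly the parts of $\mu$. Exchanging the $0$'s of rows $a\ne b$ means replacing $(z_a,z_b)$ by $(z_b,z_a)$ (when this is again a configuration). Row types: $(e,e)$: $z_i>0$ even and $\lambda_i-z_i>0$ even; $(e,o)$: $z_i>0$ even, $\lambda_i-z_i$ odd; $(o,e)$: $z_i$ odd, $\lambda_i-z_i>0$ even; $(o,o)$: $z_i$ odd, $\lambda_i-z_i$ odd; $(\emptyset,e)$: $z_i=0$, $\lambda_i$ even; $(\emptyset,o)$: $z_i=0$, $\lambda_i$ odd; $(e,\emptyset)$: $z_i=\lambda_i$ even; $(o,\emptyset)$: $z_i=\lambda_i$ odd. Let $o_r$ (resp. $e_r$) be the number of rows with $z_i=0$ and $\lambda_i$ odd (resp. even), and $o_s$ (resp. $e_s$) the number of rows with $z_i>0$ and $\lambda_i-z_i$ odd (resp. even and nonzero). Define $\kappa(\mathcal{C})=o_s+2e_s+\max\big(o_r,\ e_r+((e_r+o_r)\bmod 2)\big)$. -}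

module Defs where

open import Data.Nat using (ℕ; zero; suc; _+_; _*_; _∸_; _≤_; _<_; _>_; _⊔_; _%_)
open import Data.Bool using (Bool; true; false; if_then_else_)
open import Data.List using (List; []; _∷_; length; map; tabulate; allFin)
open import Data.Nat.ListAction using (sum)
open import Data.List.Relation.Unary.All using (All)
open import Data.List.Relation.Unary.Linked using (Linked)
open import Data.List.Relation.Binary.Permutation.Propositional using (_↭_)
open import Data.Fin using (Fin)
open import Data.Product using (_×_)
open import Relation.Binary.PropositionalEquality using (_≡_; _≢_)

StrictPartition : List ℕ → Set
StrictPartition l = All (λ x → 0 < x) l × Linked _>_ l

data _⊆ₚ_ : List ℕ → List ℕ → Set where
  []⊆  : ∀ {l} → [] ⊆ₚ l
  _∷⊆_ : ∀ {m l μ λ'} → m ≤ l → μ ⊆ₚ λ' → (m ∷ μ) ⊆ₚ (l ∷ λ')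

Row : List ℕ → Set
Row l = Fin (length l)

lookupₗ : (l : List ℕ) → Row l → ℕ
lookupₗ l i = Data.List.lookup l i

nonzeros : List ℕ → List ℕ
nonzeros [] = []
nonzeros (zero ∷ xs) = nonzeros xs
nonzeros (suc x ∷ xs) = suc x ∷ nonzeros xs

-- A configuration of 0's for λ/μ: zᵢ zeros in row i, with 0 ≤ zᵢ ≤ λᵢ, such that the
-- nonzero zᵢ's, arranged in decreasing order, are exactly the parts of μ
-- (equivalently, as μ is strictly decreasing: the nonzero zᵢ's form a permutation of μ).
IsConfiguration : (lam mu : List ℕ) → (Row lam → ℕ) → Set
IsConfiguration lam mu z =
  (∀ i → z i ≤ lookupₗ lam i) × (nonzeros (tabulate z) ↭ mu)

Exchange : ∀ {n} → (z z' : Fin n → ℕ) → (a b : Fin n) → Set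
Exchange z z' a b =
  z' a ≡ z b × z' b ≡ z a × (∀ i → i ≢ a → i ≢ b → z' i ≡ z i)

isEven : ℕ → Bool
isEven zero = true
isEven (suc zero) = false
isEven (suc (suc n)) = isEven n

data RowType : Set where
  ee eo oe oo ∅e ∅o e∅ o∅ : RowType

-- type of a row with length l containing z zeros (remaining l ∸ z squares blank)
rowType : (l z : ℕ) → RowType
rowType l zero = if isEven l then ∅e else ∅o
rowType l (suc z) with l ∸ suc z
... | zero  = if isEven (suc z) then e∅ else o∅
... | suc r = if isEven (suc z)
                then (if isEven (suc r) then ee else eo)
                else (if isEven (suc r) then oe else oo)

countFin : ∀ {n} → (Fin n → Bool) → ℕ
countFin {n} p = sum (map (λ i → if p i then 1 else 0) (allFin n))

isZero : ℕ → Bool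
isZero zero = true
isZero (suc _) = false

oᵣ eᵣ oₛ eₛ : (lam : List ℕ) → (Row lam → ℕ) → ℕ
oᵣ lam z = countFin (λ i → if isZero (z i) then (if isEven (lookupₗ lam i) then false else true) else false)
eᵣ lam z = countFin (λ i → if isZero (z i) then isEven (lookupₗ lam i) else false)
oₛ lam z = countFin (λ i → if isZero (z i) then false
                           else (if isEven (lookupₗ lam i ∸ z i) then false else true))
eₛ lam z = countFin (λ i → if isZero (z i) then false
                           else (if isEven (lookupₗ lam i ∸ z i)
                                   then (if isZero (lookupₗ lam i ∸ z i) then false else true)
                                   else false))

κ : (lam : List ℕ) → (Row lam → ℕ) → ℕ
κ lam z = (oₛ lam z + 2 * eₛ lam z)
          + (oᵣ lam z ⊔ (eᵣ lam z + ((eᵣ lam z + oᵣ lam z) % 2)))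

-- The eight allowed transitions: (type a in C, type b in C) → (type a in C', type b in C')
data AllowedExchange : RowType → RowType → RowType → RowType → Set where
  t1 : AllowedExchange ee ee ee e∅
  t2 : AllowedExchange ee oo oo e∅
  t3 : AllowedExchange eo ee eo e∅
  t4 : AllowedExchange ee ∅e ∅e e∅
  t5 : AllowedExchange oo oe oo o∅
  t6 : AllowedExchange oe eo eo o∅
  t7 : AllowedExchange oe oe oe o∅
  t8 : AllowedExchange oe ∅o ∅o o∅

-- Every statistic in κ is a count of rows by row type, and an exchange changes the types of
-- rows a and b only.  Inspecting the eight allowed exchanges, the pair of types of (a, b)
-- keeps its numbers of (∅,o), (∅,e) and (·,o) rows and loses exactly one (·,e) row (an (e,∅)
-- or (o,∅) row has no blank squares and is counted by none of the four), so
-- o_r, e_r, o_s are unchanged while e_s drops by one, and κ drops by two.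
module Submission where

open import Defs
open import Data.Nat using (ℕ; zero; suc; _+_; _*_; _<_; _∸_)
open import Data.Nat.Properties
  using (+-0-commutativeMonoid; +-suc; +-cancelʳ-≡; +-monoˡ-<; +-monoʳ-<; *-monoʳ-<; n<1+n)
open import Data.Nat.Solver using (module +-*-Solver)
import Data.Nat.ListAction as List
open import Data.List using (List; tabulate)
open import Data.List.Properties using (map-tabulate)
open import Data.Fin using (Fin; zero; suc; _≟_; punchIn)
open import Data.Fin.Properties using (punchInᵢ≢i)
open import Data.Bool using (Bool; true; false; if_then_else_)
open import Data.Vec.Functional using (Vector; updateAt; removeAt)
open import Data.Vec.Functional.Properties using (updateAt-updates; updateAt-minimal)
open import Algebra.Properties.CommutativeMonoid.Sum +-0-commutativeMonoid
  using (sum; sum-remove; sum-cong-≗)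
open import Data.Product using (_×_; _,_; proj₁; proj₂)
open import Function using (_∘_; const)
open import Relation.Nullary using (yes; no)
open import Relation.Binary.PropositionalEquality

open +-*-Solver using (solve; _:+_; _:=_)

sum-update : ∀ {n} (f g : Vector ℕ n) (a : Fin n) → (∀ i → i ≢ a → f i ≡ g i) →
             sum f + g a ≡ sum g + f a
sum-update {suc n} f g a f≡g = begin
  sum f + g a                          ≡⟨ cong (_+ g a) (sum-remove {i = a} f) ⟩
  (f a + sum (removeAt f a)) + g a     ≡⟨ cong (λ r → (f a + r) + g a) (sum-cong-≗ rest≗) ⟩
  (f a + sum (removeAt g a)) + g a     ≡⟨ swap (f a) (sum (removeAt g a)) (g a) ⟩
  (g a + sum (removeAt g a)) + f a     ≡⟨ cong (_+ f a) (sum-remove {i = a} g) ⟨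
  sum g + f a                          ∎
  where
    open ≡-Reasoning
    rest≗ : ∀ j → removeAt f a j ≡ removeAt g a j
    rest≗ j = f≡g (punchIn a j) (punchInᵢ≢i a j)
    swap : ∀ x r y → (x + r) + y ≡ (y + r) + x
    swap = solve 3 (λ x r y → (x :+ r) :+ y := (y :+ r) :+ x) refl

sum-exchange : ∀ {n} (f g : Vector ℕ n) {a b : Fin n} → a ≢ b →
               (∀ i → i ≢ a → i ≢ b → f i ≡ g i) →
               sum f + (g a + g b) ≡ sum g + (f a + f b)
sum-exchange f g {a} {b} a≢b f≡g = begin
  sum f + (g a + g b)     ≡⟨ reassoc (sum f) (g a) (g b) ⟩
  (sum f + g a) + g b     ≡⟨ cong (λ x → (sum f + x) + g b) (updateAt-updates a f) ⟨
  (sum f + h a) + g b     ≡⟨ cong (_+ g b) (sum-update f h a f≡h) ⟩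
  (sum h + f a) + g b     ≡⟨ swap (sum h) (f a) (g b) ⟩
  (sum h + g b) + f a     ≡⟨ cong (_+ f a) (sum-update h g b h≡g) ⟩
  (sum g + h b) + f a     ≡⟨ cong (λ x → (sum g + x) + f a) (updateAt-minimal b a f (a≢b ∘ sym)) ⟩
  (sum g + f b) + f a     ≡⟨ swap (sum g) (f b) (f a) ⟩
  (sum g + f a) + f b     ≡⟨ reassoc (sum g) (f a) (f b) ⟨
  sum g + (f a + f b)     ∎
  where
    open ≡-Reasoning
    h : Vector ℕ _
    h = updateAt f a (const (g a))
    f≡h : ∀ i → i ≢ a → f i ≡ h i
    f≡h i i≢a = sym (updateAt-minimal i a f i≢a)
    h≡g : ∀ i → i ≢ b → h i ≡ g i
    h≡g i i≢b with i ≟ a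
    ... | yes refl = updateAt-updates a f
    ... | no i≢a   = trans (updateAt-minimal i a f i≢a) (f≡g i i≢a i≢b)
    reassoc : ∀ x y w → x + (y + w) ≡ (x + y) + w
    reassoc = solve 3 (λ x y w → x :+ (y :+ w) := (x :+ y) :+ w) refl
    swap : ∀ x y w → (x + y) + w ≡ (x + w) + y
    swap = solve 3 (λ x y w → (x :+ y) :+ w := (x :+ w) :+ y) refl

indicator : Bool → ℕ
indicator b = if b then 1 else 0

sum-tabulate : ∀ {n} (f : Vector ℕ n) → List.sum (tabulate f) ≡ sum f
sum-tabulate {zero}  f = refl
sum-tabulate {suc n} f = cong (f zero +_) (sum-tabulate (f ∘ suc))

countFin-sum : ∀ {n} (p : Fin n → Bool) → countFin p ≡ sum (indicator ∘ p)
countFin-sum p = trans (cong List.sum (map-tabulate (λ i → i) (indicator ∘ p)))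
                           (sum-tabulate (indicator ∘ p))

countFin-exchange : ∀ {n} (p q : Fin n → Bool) {a b : Fin n} → a ≢ b →
                    (∀ i → i ≢ a → i ≢ b → p i ≡ q i) →
                    countFin p + (indicator (q a) + indicator (q b))
                      ≡ countFin q + (indicator (p a) + indicator (p b))
countFin-exchange p q a≢b p≡q
  rewrite countFin-sum p | countFin-sum q =
  sum-exchange (indicator ∘ p) (indicator ∘ q) a≢b (λ i i≢a i≢b → cong indicator (p≡q i i≢a i≢b))

module _ {n} (p q : Fin n → Bool) {a b : Fin n} (a≢b : a ≢ b)
         (p≡q : ∀ i → i ≢ a → i ≢ b → p i ≡ q i) where

  countFin-preserved-by-exchange :
    indicator (p a) + indicator (p b) ≡ indicator (q a) + indicator (q b) →
    countFin p ≡ countFin q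
  countFin-preserved-by-exchange same =
    +-cancelʳ-≡ _ _ _ (trans (countFin-exchange p q a≢b p≡q) (cong (countFin q +_) same))

  countFin-lowered-by-exchange :
    indicator (p a) + indicator (p b) ≡ suc (indicator (q a) + indicator (q b)) →
    countFin p ≡ suc (countFin q)
  countFin-lowered-by-exchange lower =
    +-cancelʳ-≡ _ _ _ (begin
      countFin p + (indicator (q a) + indicator (q b))     ≡⟨ countFin-exchange p q a≢b p≡q ⟩
      countFin q + (indicator (p a) + indicator (p b))     ≡⟨ cong (countFin q +_) lower ⟩
      countFin q + suc (indicator (q a) + indicator (q b)) ≡⟨ +-suc (countFin q) _ ⟩
      suc (countFin q) + (indicator (q a) + indicator (q b)) ∎)
    where open ≡-Reasoning

-- Verbatim the predicates inside oᵣ, eᵣ, oₛ, eₛ, so that e.g. oᵣ lam z is definitionally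
-- countFin (λ i → oᵣ-row (lookupₗ lam i) (z i)).
oᵣ-row eᵣ-row oₛ-row eₛ-row : ℕ → ℕ → Bool
oᵣ-row l zz = if isZero zz then (if isEven l then false else true) else false
eᵣ-row l zz = if isZero zz then isEven l else false
oₛ-row l zz = if isZero zz then false else (if isEven (l ∸ zz) then false else true)
eₛ-row l zz = if isZero zz then false
              else (if isEven (l ∸ zz) then (if isZero (l ∸ zz) then false else true) else false)

is-∅o is-∅e is-·o is-·e : RowType → Bool
is-∅o ∅o = true
is-∅o _  = false
is-∅e ∅e = true
is-∅e _  = false
is-·o eo = true
is-·o oo = true
is-·o _  = false
is-·e ee = true
is-·e oe = true
is-·e _  = false

rowType-classifies : ∀ l zz →
  oᵣ-row l zz ≡ is-∅o (rowType l zz) × eᵣ-row l zz ≡ is-∅e (rowType l zz) ×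
  oₛ-row l zz ≡ is-·o (rowType l zz) × eₛ-row l zz ≡ is-·e (rowType l zz)
rowType-classifies l zero with isEven l
... | true  = refl , refl , refl , refl
... | false = refl , refl , refl , refl
rowType-classifies l (suc z) with l ∸ suc z
... | zero with isEven (suc z)
...   | true  = refl , refl , refl , refl
...   | false = refl , refl , refl , refl
rowType-classifies l (suc z) | suc r with isEven (suc z) | isEven (suc r)
... | true  | true  = refl , refl , refl , refl
... | true  | false = refl , refl , refl , refl
... | false | true  = refl , refl , refl , refl
... | false | false = refl , refl , refl , refl

oᵣ-row-rowType : ∀ l zz → oᵣ-row l zz ≡ is-∅o (rowType l zz)
oᵣ-row-rowType l zz = proj₁ (rowType-classifies l zz)

eᵣ-row-rowType : ∀ l zz → eᵣ-row l zz ≡ is-∅e (rowType l zz)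
eᵣ-row-rowType l zz = proj₁ (proj₂ (rowType-classifies l zz))

oₛ-row-rowType : ∀ l zz → oₛ-row l zz ≡ is-·o (rowType l zz)
oₛ-row-rowType l zz = proj₁ (proj₂ (proj₂ (rowType-classifies l zz)))

eₛ-row-rowType : ∀ l zz → eₛ-row l zz ≡ is-·e (rowType l zz)
eₛ-row-rowType l zz = proj₂ (proj₂ (proj₂ (rowType-classifies l zz)))

tally : (RowType → Bool) → RowType → RowType → ℕ
tally c T U = indicator (c T) + indicator (c U)

allowedExchange-tallies : ∀ {T U T′ U′} → AllowedExchange T U T′ U′ →
  tally is-∅o T U ≡ tally is-∅o T′ U′ × tally is-∅e T U ≡ tally is-∅e T′ U′ ×
  tally is-·o T U ≡ tally is-·o T′ U′ × tally is-·e T U ≡ suc (tally is-·e T′ U′)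
allowedExchange-tallies t1 = refl , refl , refl , refl
allowedExchange-tallies t2 = refl , refl , refl , refl
allowedExchange-tallies t3 = refl , refl , refl , refl
allowedExchange-tallies t4 = refl , refl , refl , refl
allowedExchange-tallies t5 = refl , refl , refl , refl
allowedExchange-tallies t6 = refl , refl , refl , refl
allowedExchange-tallies t7 = refl , refl , refl , refl
allowedExchange-tallies t8 = refl , refl , refl , refl

κ-lowered : (lam : List ℕ) (z z′ : Row lam → ℕ) →
  oᵣ lam z′ ≡ oᵣ lam z → eᵣ lam z′ ≡ eᵣ lam z → oₛ lam z′ ≡ oₛ lam z →
  eₛ lam z ≡ suc (eₛ lam z′) → κ lam z′ < κ lam z
κ-lowered lam z z′ o≡ e≡ os≡ es≡ rewrite o≡ | e≡ | os≡ | es≡ =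
  +-monoˡ-< _ (+-monoʳ-< (oₛ lam z) (*-monoʳ-< 2 (n<1+n (eₛ lam z′))))

module _ (lam : List ℕ) {z z′ : Row lam → ℕ} {a b : Row lam} (a≢b : a ≢ b)
         (z′≡z : ∀ i → i ≢ a → i ≢ b → z′ i ≡ z i)
         (P : ℕ → ℕ → Bool) (c : RowType → Bool) (P≡c : ∀ l zz → P l zz ≡ c (rowType l zz))
         where

  private
    L = lookupₗ lam

  counted : (Row lam → ℕ) → Row lam → Bool
  counted w i = P (L i) (w i)

  tallyAt : (Row lam → ℕ) → ℕ
  tallyAt w = tally c (rowType (L a) (w a)) (rowType (L b) (w b))

  private
    local : ∀ w → indicator (counted w a) + indicator (counted w b) ≡ tallyAt w
    local w = cong₂ _+_ (cong indicator (P≡c _ _)) (cong indicator (P≡c _ _))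

    unchanged : ∀ i → i ≢ a → i ≢ b → counted z′ i ≡ counted z i
    unchanged i i≢a i≢b = cong (P (L i)) (z′≡z i i≢a i≢b)

  count-preserved-by-exchange : tallyAt z′ ≡ tallyAt z →
                                countFin (counted z′) ≡ countFin (counted z)
  count-preserved-by-exchange same =
    countFin-preserved-by-exchange (counted z′) (counted z) a≢b unchanged
      (trans (local z′) (trans same (sym (local z))))

  count-lowered-by-exchange : tallyAt z ≡ suc (tallyAt z′) →
                              countFin (counted z) ≡ suc (countFin (counted z′))
  count-lowered-by-exchange lower =
    countFin-lowered-by-exchange (counted z) (counted z′) a≢b
      (λ i i≢a i≢b → sym (unchanged i i≢a i≢b))
      (trans (local z) (trans lower (cong suc (sym (local z′)))))

mainTheorem12 : (lam mu : List ℕ) → StrictPartition lam → StrictPartition mu → mu ⊆ₚ lam →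
    (z z' : Row lam → ℕ) → IsConfiguration lam mu z → IsConfiguration lam mu z' →
    (a b : Row lam) → a ≢ b → Exchange z z' a b →
    AllowedExchange (rowType (lookupₗ lam a) (z a)) (rowType (lookupₗ lam b) (z b))
                    (rowType (lookupₗ lam a) (z' a)) (rowType (lookupₗ lam b) (z' b)) →
    κ lam z' < κ lam z
mainTheorem12 lam _ _ _ _ z z′ _ _ a b a≢b (_ , _ , z′≡z) allowed =
  let (∅o≡ , ∅e≡ , ·o≡ , ·e≡) = allowedExchange-tallies allowed in
  κ-lowered lam z z′
    (count-preserved-by-exchange lam a≢b z′≡z oᵣ-row is-∅o oᵣ-row-rowType (sym ∅o≡))
    (count-preserved-by-exchange lam a≢b z′≡z eᵣ-row is-∅e eᵣ-row-rowType (sym ∅e≡))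
    (count-preserved-by-exchange lam a≢b z′≡z oₛ-row is-·o oₛ-row-rowType (sym ·o≡))
    (count-lowered-by-exchange lam a≢b z′≡z eₛ-row is-·e eₛ-row-rowType ·e≡)
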